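{- Let $t\ge1$ be an integer such that a $(4t-1,2t-1,t-1)$ skew-Hadamard design exists. Then for every integer $m\ge2$ there exists a self-dual rectangular design with parameters $v=b=m(4t-1)$, $r=k=m(2t-1)+1$, $\lambda_1=m(t-1)+1$, $\lambda_2=(m-2)(2t-1)$, $\lambda_3=m(t-1)+2$, $m$, $n=4t-1$.
   Context: A $(4t-1,2t-1,t-1)$ skew-Hadamard design is a symmetric design on $4t-1$ treatments with blocks of size $2t-1$, any two treatments together in $t-1$ blocks, whose incidence matrix $N$ satisfies $N+N^T=J-I$. A rectangular design (RD) with parameters $v=mn,b,r,k,\lambda_1,\lambda_2,\lambda_3,m,n$ has its treatments arranged in an $m\times n$ array, $b$ blocks of size $k$, replication $r$, and any two distinct treatments occur together in $\lambda_1$ blocks if in the same row, $\lambda_2$ if in the same column, $\lambda_3$ otherwise. It is self-dual if the design with transposed incidence matrix is an RD with the same parameters. -}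

module Defs where

open import Data.Nat using (ℕ; zero; suc; _+_; _*_; _∸_; _≥_)
open import Data.Bool using (Bool; true; false; if_then_else_; _∧_)
open import Data.Fin using (Fin; _≟_) renaming (zero to Fz; suc to Fs)
open import Data.Product using (_×_; proj₁; proj₂; Σ)
open import Function.Bundles using (_↔_; Inverse)
open import Relation.Binary.PropositionalEquality using (_≡_; _≢_)
open import Relation.Nullary using (does)

b2n : Bool → ℕ
b2n true  = 1
b2n false = 0

count : ∀ {n} → (Fin n → Bool) → ℕ
count {zero}  f = 0
count {suc n} f = b2n (f Fz) + count (λ i → f (Fs i))


-- incidence matrix: rows = treatments, columns = blocks
Incidence : ℕ → ℕ → Set
Incidence v b = Fin v → Fin b → Bool

transpose : ∀ {v b} → Incidence v b → Incidence b v
transpose N j i = N i j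

together : ∀ {v b} → Incidence v b → Fin v → Fin v → ℕ
together N i j = count (λ x → N i x ∧ N j x)

blockSize : ∀ {v b} → Incidence v b → Fin b → ℕ
blockSize N x = count (λ i → N i x)

replication : ∀ {v b} → Incidence v b → Fin v → ℕ
replication N i = count (λ x → N i x)

JminusI : ∀ {v} → Fin v → Fin v → ℕ
JminusI i j = if does (i ≟ j) then 0 else 1

record IsSymmetricDesign (v k lam : ℕ) (N : Incidence v v) : Set where
  field
    blockSizes : ∀ x → blockSize N x ≡ k
    pairs      : ∀ i j → i ≢ j → together N i j ≡ lam

record IsSkewHadamard (t : ℕ) (N : Incidence (4 * t ∸ 1) (4 * t ∸ 1)) : Set where
  field
    design : IsSymmetricDesign (4 * t ∸ 1) (2 * t ∸ 1) (t ∸ 1) N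
    skew   : ∀ i j → b2n (N i j) + b2n (transpose N i j) ≡ JminusI i j

SkewHadamardExists : ℕ → Set
SkewHadamardExists t = Σ (Incidence (4 * t ∸ 1) (4 * t ∸ 1)) (IsSkewHadamard t)

record IsRD (b r k λ₁ λ₂ λ₃ m n : ℕ) (N : Incidence (m * n) b) : Set where
  field
    array       : Fin (m * n) ↔ (Fin m × Fin n)
    blockSizes  : ∀ x → blockSize N x ≡ k
    replications : ∀ i → replication N i ≡ r
    sameRow     : ∀ i j → i ≢ j →
                  proj₁ (Inverse.to array i) ≡ proj₁ (Inverse.to array j) →
                  together N i j ≡ λ₁
    sameCol     : ∀ i j → i ≢ j →
                  proj₂ (Inverse.to array i) ≡ proj₂ (Inverse.to array j) →
                  together N i j ≡ λ₂
    otherwise   : ∀ i j →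
                  proj₁ (Inverse.to array i) ≢ proj₁ (Inverse.to array j) →
                  proj₂ (Inverse.to array i) ≢ proj₂ (Inverse.to array j) →
                  together N i j ≡ λ₃

IsSelfDualRD : (r k λ₁ λ₂ λ₃ m n : ℕ) → Incidence (m * n) (m * n) → Set
IsSelfDualRD r k λ₁ λ₂ λ₃ m n N =
  IsRD (m * n) r k λ₁ λ₂ λ₃ m n N × IsRD (m * n) r k λ₁ λ₂ λ₃ m n (transpose N)

-- Take the m × m block matrix with diagonal blocks J − Nᵀ (= N + I for a skew design) and
-- off-diagonal blocks Nᵀ. Each replication number and each intersection of two of its rows is a
-- sum over the m block columns of sizes and pairwise intersections of columns of N and of their
-- complements; with n = 2k + 1 and k = 2λ + 1 these are k, λ, k + 1, λ + 1 and 0, and the two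
-- mixed intersections |c̄ᵢ ∩ cⱼ| + |cᵢ ∩ c̄ⱼ| add up to k + 1. That the columns of N have the same
-- parameters as its rows follows from N + Nᵀ + I = J, which splits every count along a row or a
-- column of N into three pieces. Transposing the block matrix yields the same construction for
-- Nᵀ, again a skew design; hence the design is self-dual.
module Submission where

open import Defs
open import Algebra.Properties.CommutativeSemigroup using (interchange)
open import Data.Empty using (⊥-elim)
open import Data.Bool using (Bool; true; false; not; _∧_; _xor_; if_then_else_)
open import Data.Bool.Properties using (∧-comm; ∧-idem; ∧-inverseˡ)
open import Data.Fin using (Fin; _≟_; combine; remQuot; _↑ˡ_; _↑ʳ_) renaming (zero to Fz; suc to Fs)
open import Data.Fin.Properties using (remQuot-combine; combine-remQuot; *↔×)
open import Data.Nat using (ℕ; zero; suc; _+_; _*_; _∸_; _≥_)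
open import Data.Nat.Properties
  using (+-*-semiring; +-commutativeSemigroup; +-comm; +-assoc; +-suc; +-identityʳ;
         +-cancelʳ-≡; suc-injective; *-zeroʳ; m+n∸n≡m; *-distribʳ-∸)
open import Data.Nat.Tactic.RingSolver using (solve-∀)
open import Data.Product using (_×_; _,_; proj₁; proj₂; Σ; uncurry)
open import Function using (_∘_)
open import Relation.Binary.PropositionalEquality
open import Relation.Nullary using (does; yes; no)
open import Relation.Nullary.Decidable using (dec-true; dec-false)
open import Algebra.Properties.Semiring.Sum +-*-semiring using (sum; sum-cong-≗; ∑-distrib-+)

open ≡-Reasoning

variable
  m n k l : ℕ

b2n-not : ∀ b → b2n (not b) + b2n b ≡ 1
b2n-not true  = refl
b2n-not false = refl

b2n-not-∧ : ∀ a b → b2n (not a ∧ b) + b2n (a ∧ b) ≡ b2n b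
b2n-not-∧ true  b = refl
b2n-not-∧ false b = +-identityʳ (b2n b)

b2n-∧-partition : ∀ u a b c → b2n a + b2n b + b2n c ≡ 1 →
                  b2n (u ∧ a) + b2n (u ∧ b) + b2n (u ∧ c) ≡ b2n u
b2n-∧-partition false a b c _ = refl
b2n-∧-partition true  a b c e = e

JminusI-+-b2n : ∀ (i j : Fin n) → JminusI i j + b2n (does (i ≟ j)) ≡ 1
JminusI-+-b2n i j with does (i ≟ j)
... | true  = refl
... | false = refl

does-≟-comm : ∀ (a c : Fin m) → does (a ≟ c) ≡ does (c ≟ a)
does-≟-comm a c with a ≟ c
... | yes refl = sym (dec-true (a ≟ a) refl)
... | no a≢c   = sym (dec-false (c ≟ a) (a≢c ∘ sym))

count-sum : (f : Fin n → Bool) → count f ≡ sum (b2n ∘ f)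
count-sum {zero}  f = refl
count-sum {suc n} f = cong (b2n (f Fz) +_) (count-sum (f ∘ Fs))

count-cong : {f g : Fin n → Bool} → (∀ x → f x ≡ g x) → count f ≡ count g
count-cong {zero}  e = refl
count-cong {suc n} e = cong₂ _+_ (cong b2n (e Fz)) (count-cong (e ∘ Fs))

count-true : ∀ n → count {n} (λ _ → true) ≡ n
count-true zero    = refl
count-true (suc n) = cong suc (count-true n)

count-false : ∀ n → count {n} (λ _ → false) ≡ 0
count-false zero    = refl
count-false (suc n) = count-false n

count-partition : {f g h : Fin n → Bool} → (∀ x → b2n (f x) + b2n (g x) ≡ b2n (h x)) →
                  count f + count g ≡ count h
count-partition {f = f} {g} {h} e = begin
  count f + count g                       ≡⟨ cong₂ _+_ (count-sum f) (count-sum g) ⟩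
  sum (b2n ∘ f) + sum (b2n ∘ g)           ≡⟨ ∑-distrib-+ (b2n ∘ f) (b2n ∘ g) ⟨
  sum (λ x → b2n (f x) + b2n (g x))       ≡⟨ sum-cong-≗ e ⟩
  sum (b2n ∘ h)                           ≡⟨ count-sum h ⟨
  count h                                 ∎

count-partition₃ : {f g h u : Fin n → Bool} →
                   (∀ x → b2n (f x) + b2n (g x) + b2n (h x) ≡ b2n (u x)) →
                   count f + count g + count h ≡ count u
count-partition₃ {f = f} {g} {h} {u} e = begin
  count f + count g + count h
    ≡⟨ cong₂ _+_ (cong₂ _+_ (count-sum f) (count-sum g)) (count-sum h) ⟩
  sum (b2n ∘ f) + sum (b2n ∘ g) + sum (b2n ∘ h)
    ≡⟨ cong (_+ sum (b2n ∘ h)) (∑-distrib-+ (b2n ∘ f) (b2n ∘ g)) ⟨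
  sum (λ x → b2n (f x) + b2n (g x)) + sum (b2n ∘ h)
    ≡⟨ ∑-distrib-+ (λ x → b2n (f x) + b2n (g x)) (b2n ∘ h) ⟨
  sum (λ x → b2n (f x) + b2n (g x) + b2n (h x))
    ≡⟨ sum-cong-≗ e ⟩
  sum (b2n ∘ u)
    ≡⟨ count-sum u ⟨
  count u
    ∎

count-≟-∧ : ∀ (i : Fin n) (u : Fin n → Bool) → count (λ x → does (i ≟ x) ∧ u x) ≡ b2n (u i)
count-≟-∧ {suc n} Fz     u = trans (cong (b2n (u Fz) +_) (count-false n)) (+-identityʳ _)
count-≟-∧ {suc n} (Fs i) u = count-≟-∧ i (u ∘ Fs)

count-not : (u : Fin n → Bool) → count (not ∘ u) + count u ≡ n
count-not {n} u = trans (count-partition (b2n-not ∘ u)) (count-true n)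

count-not-∧ : (u v : Fin n → Bool) →
              count (λ x → not (u x) ∧ v x) + count (λ x → u x ∧ v x) ≡ count v
count-not-∧ u v = count-partition (λ x → b2n-not-∧ (u x) (v x))

count-not-∧-self : (u : Fin n → Bool) → count (λ x → not (u x) ∧ u x) ≡ 0
count-not-∧-self {n} u = trans (count-cong (∧-inverseˡ ∘ u)) (count-false n)

count-∧-comm : (u v : Fin n → Bool) → count (λ x → u x ∧ v x) ≡ count (λ x → v x ∧ u x)
count-∧-comm u v = count-cong (λ x → ∧-comm (u x) (v x))

count-++ : ∀ m (f : Fin (m + n) → Bool) → count f ≡ count (f ∘ (_↑ˡ n)) + count (f ∘ (m ↑ʳ_))
count-++ zero    f = refl
count-++ (suc m) f = trans (cong (b2n (f Fz) +_) (count-++ m (f ∘ Fs))) (sym (+-assoc (b2n (f Fz)) _ _))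

count-combine : ∀ m (f : Fin (m * n) → Bool) →
                count f ≡ sum {m} (λ c → count (λ x → f (combine c x)))
count-combine zero        f = refl
count-combine {n} (suc m) f =
  trans (count-++ n f) (cong (count (f ∘ (_↑ˡ (m * n))) +_) (count-combine m (f ∘ (n ↑ʳ_))))

count-remQuot : ∀ m (F : Fin m × Fin n → Bool) →
                count (λ p → F (remQuot n p)) ≡ sum (λ c → count (λ x → F (c , x)))
count-remQuot {n} m F = trans (count-combine m (F ∘ remQuot n))
  (sum-cong-≗ (λ c → count-cong (λ x → cong F (remQuot-combine c x))))

remQuot-injective : ∀ (p q : Fin (m * n)) → remQuot {m} n p ≡ remQuot n q → p ≡ q
remQuot-injective {m} {n} p q e =
  trans (sym (combine-remQuot {m} n p)) (trans (cong (uncurry combine) e) (combine-remQuot {m} n q))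

sum-const : ∀ m w → sum {m} (λ _ → w) ≡ m * w
sum-const zero    w = refl
sum-const (suc m) w = cong (w +_) (sum-const m w)

point : Fin m → ℕ → Fin m → ℕ
point a w c = if does (a ≟ c) then w else 0

sum-point : ∀ (a : Fin m) w → sum (point a w) ≡ w
sum-point {suc m} Fz     w = trans (cong (w +_) (trans (sum-const m 0) (*-zeroʳ m))) (+-identityʳ w)
sum-point {suc m} (Fs a) w = sum-point a w

sum-except₁ : ∀ (g : Fin m → ℕ) (a : Fin m) {w} → g a ≡ suc w → (∀ c → a ≢ c → g c ≡ w) →
              sum g ≡ m * w + 1
sum-except₁ {m} g a {w} ga gc = begin
  sum g                            ≡⟨ sum-cong-≗ shift ⟩
  sum (λ c → w + point a 1 c)      ≡⟨ ∑-distrib-+ (λ _ → w) (point a 1) ⟩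
  sum {m} (λ _ → w) + sum (point a 1)  ≡⟨ cong₂ _+_ (sum-const m w) (sum-point a 1) ⟩
  m * w + 1                        ∎
  where
  shift : ∀ c → g c ≡ w + point a 1 c
  shift c with a ≟ c
  ... | yes refl = trans ga (+-comm 1 w)
  ... | no a≢c   = trans (gc c a≢c) (sym (+-identityʳ w))

sum-except₂ : ∀ (g : Fin m → ℕ) (a b : Fin m) {w} → a ≢ b →
              (∀ c → a ≢ c → b ≢ c → g c ≡ w) →
              sum g + (w + w) ≡ g a + g b + m * w
sum-except₂ {m} g a b {w} a≢b gc = begin
  sum g + (w + w)
    ≡⟨ cong (sum g +_) (cong₂ _+_ (sum-point a w) (sum-point b w)) ⟨
  sum g + (sum (point a w) + sum (point b w))
    ≡⟨ cong (sum g +_) (∑-distrib-+ (point a w) (point b w)) ⟨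
  sum g + sum (λ c → point a w c + point b w c)
    ≡⟨ ∑-distrib-+ g _ ⟨
  sum (λ c → g c + (point a w c + point b w c))
    ≡⟨ sum-cong-≗ shift ⟩
  sum (λ c → point a (g a) c + point b (g b) c + w)
    ≡⟨ ∑-distrib-+ (λ c → point a (g a) c + point b (g b) c) (λ _ → w) ⟩
  sum (λ c → point a (g a) c + point b (g b) c) + sum {m} (λ _ → w)
    ≡⟨ cong₂ _+_ (∑-distrib-+ (point a (g a)) (point b (g b))) (sum-const m w) ⟩
  sum (point a (g a)) + sum (point b (g b)) + m * w
    ≡⟨ cong (_+ m * w) (cong₂ _+_ (sum-point a (g a)) (sum-point b (g b))) ⟩
  g a + g b + m * w
    ∎
  where
  shift : ∀ c → g c + (point a w c + point b w c) ≡ point a (g a) c + point b (g b) c + w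
  shift c with a ≟ c | b ≟ c
  ... | yes refl | yes refl = ⊥-elim (a≢b refl)
  ... | yes refl | no _     = trans (cong (g c +_) (+-identityʳ w)) (cong (_+ w) (sym (+-identityʳ (g c))))
  ... | no _     | yes refl = refl
  ... | no a≢c   | no b≢c   = trans (+-identityʳ (g c)) (gc c a≢c b≢c)

module _ {N : Incidence n n} (skew : ∀ i j → b2n (N i j) + b2n (N j i) ≡ JminusI i j) where

  skew-trichotomy : ∀ j x → b2n (N j x) + b2n (N x j) + b2n (does (j ≟ x)) ≡ 1
  skew-trichotomy j x = trans (cong (_+ b2n (does (j ≟ x))) (skew j x)) (JminusI-+-b2n j x)

  count-skew-split : ∀ (u : Fin n → Bool) j →
                     count (λ x → u x ∧ N j x) + count (λ x → u x ∧ N x j) + b2n (u j) ≡ count u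
  count-skew-split u j = begin
    count (λ x → u x ∧ N j x) + count (λ x → u x ∧ N x j) + b2n (u j)
      ≡⟨ cong (count (λ x → u x ∧ N j x) + count (λ x → u x ∧ N x j) +_) (count-≟-∧ j u) ⟨
    count (λ x → u x ∧ N j x) + count (λ x → u x ∧ N x j) + count (λ x → does (j ≟ x) ∧ u x)
      ≡⟨ cong (count (λ x → u x ∧ N j x) + count (λ x → u x ∧ N x j) +_) (count-∧-comm _ u) ⟩
    count (λ x → u x ∧ N j x) + count (λ x → u x ∧ N x j) + count (λ x → u x ∧ does (j ≟ x))
      ≡⟨ count-partition₃ (λ x → b2n-∧-partition (u x) _ _ _ (skew-trichotomy j x)) ⟩
    count u
      ∎

  transpose-isSymmetricDesign : IsSymmetricDesign n k l N → n ≡ suc (k + k) →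
                                IsSymmetricDesign n k l (transpose N)
  transpose-isSymmetricDesign {k} {l} D n≡ = record { blockSizes = rowSize ; pairs = columnMeet }
    where
    open IsSymmetricDesign D

    rowSize : ∀ i → count (N i) ≡ k
    rowSize i = +-cancelʳ-≡ k _ k (suc-injective (begin
      suc (count (N i) + k)                   ≡⟨ +-comm 1 _ ⟩
      count (N i) + k + 1                     ≡⟨ cong (λ c → count (N i) + c + 1) (blockSizes i) ⟨
      count (N i) + count (λ x → N x i) + 1   ≡⟨ count-skew-split (λ _ → true) i ⟩
      count {n} (λ _ → true)                  ≡⟨ trans (count-true n) n≡ ⟩
      suc (k + k)                             ∎))

    columnMeet : ∀ i j → i ≢ j → count (λ x → N x i ∧ N x j) ≡ l
    columnMeet i j i≢j = cancel (count-skew-split (λ x → N x i) j) (begin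
      l + dⱼᵢ + b2n (N j i)
        ≡⟨ cong₂ (λ p q → p + q + b2n (N j i))
                 (pairs j i (i≢j ∘ sym)) (count-∧-comm (N j) (λ x → N x i)) ⟨
      count (λ x → N j x ∧ N i x) + count (λ x → N j x ∧ N x i) + b2n (N j i)
        ≡⟨ count-skew-split (N j) i ⟩
      count (N j)
        ≡⟨ rowSize j ⟩
      k
        ≡⟨ blockSizes i ⟨
      count (λ x → N x i)
        ∎)
      where
      dⱼᵢ = count (λ x → N x i ∧ N j x)
      cancel : ∀ {a c e s} → a + c + e ≡ s → l + a + e ≡ s → c ≡ l
      cancel {a} {c} {e} p q = +-cancelʳ-≡ (a + e) c l (begin
        c + (a + e)   ≡⟨ +-assoc c a e ⟨
        c + a + e     ≡⟨ cong (_+ e) (+-comm c a) ⟩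
        a + c + e     ≡⟨ trans p (sym q) ⟩
        l + a + e     ≡⟨ +-assoc l a e ⟩
        l + (a + e)   ∎)

blockEntry : Incidence n n → Fin m × Fin n → Fin m × Fin n → Bool
blockEntry N (a , i) (c , x) = does (a ≟ c) xor N x i

blockIncidence : ∀ m → Incidence n n → Incidence (m * n) (m * n)
blockIncidence {n} m N p q = blockEntry N (remQuot {m} n p) (remQuot {m} n q)

blockEntry-diag : ∀ (N : Incidence n n) (a : Fin m) i x → blockEntry N (a , i) (a , x) ≡ not (N x i)
blockEntry-diag N a i x = cong (_xor N x i) (dec-true (a ≟ a) refl)

blockEntry-off : ∀ (N : Incidence n n) {a c : Fin m} i x → a ≢ c → blockEntry N (a , i) (c , x) ≡ N x i
blockEntry-off N {a} {c} i x a≢c = cong (_xor N x i) (dec-false (a ≟ c) a≢c)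

transpose-blockIncidence : ∀ m (N : Incidence n n) p q →
                           blockIncidence m N q p ≡ blockIncidence m (transpose N) p q
transpose-blockIncidence {n} m N p q =
  cong (_xor N (proj₂ (remQuot {m} n p)) (proj₂ (remQuot {m} n q)))
       (does-≟-comm (proj₁ (remQuot {m} n q)) (proj₁ (remQuot {m} n p)))

blockMeet : Incidence n n → Fin m × Fin n → Fin m × Fin n → Fin m → ℕ
blockMeet N P Q c = count (λ x → blockEntry N P (c , x) ∧ blockEntry N Q (c , x))

together-blockIncidence : ∀ m (N : Incidence n n) p q →
  together (blockIncidence m N) p q ≡ sum (blockMeet N (remQuot {m} n p) (remQuot {m} n q))
together-blockIncidence {n} m N p q =
  count-remQuot m (λ R → blockEntry N (remQuot {m} n p) R ∧ blockEntry N (remQuot {m} n q) R)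

module _ {N : Incidence n n} (columnSize : ∀ i → count (λ x → N x i) ≡ k) where

  count-not-column : n ≡ suc (k + k) → ∀ i → count (λ x → not (N x i)) ≡ suc k
  count-not-column n≡ i = +-cancelʳ-≡ k _ (suc k) (begin
    count (λ x → not (N x i)) + k                    ≡⟨ cong (_ +_) (columnSize i) ⟨
    count (λ x → not (N x i)) + count (λ x → N x i)  ≡⟨ count-not (λ x → N x i) ⟩
    n                                                ≡⟨ n≡ ⟩
    suc (k + k)                                      ∎)

  replication-blockIncidence : ∀ m → n ≡ suc (k + k) → ∀ p →
                               replication (blockIncidence m N) p ≡ m * k + 1
  replication-blockIncidence m n≡ p =
    trans (count-remQuot m (blockEntry N (a , i))) (sum-except₁ _ a diagonal offDiagonal)
    where
    a = proj₁ (remQuot {m} n p)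
    i = proj₂ (remQuot {m} n p)
    diagonal : count (λ x → blockEntry N (a , i) (a , x)) ≡ suc k
    diagonal = trans (count-cong (blockEntry-diag N a i)) (count-not-column n≡ i)
    offDiagonal : ∀ c → a ≢ c → count (λ x → blockEntry N (a , i) (c , x)) ≡ k
    offDiagonal c a≢c = trans (count-cong (λ x → blockEntry-off N i x a≢c)) (columnSize i)

  blockMeets-sameColumn : ∀ {a b : Fin m} {i j} → a ≢ b → i ≡ j →
                          sum (blockMeet N (a , i) (b , j)) ≡ (m ∸ 2) * k
  blockMeets-sameColumn {m} {a} {b} {i} a≢b refl = begin
    sum g                        ≡⟨ m+n∸n≡m (sum g) (k + k) ⟨
    sum g + (k + k) ∸ (k + k)    ≡⟨ cong (_∸ (k + k)) (sum-except₂ g a b a≢b offDiagonal) ⟩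
    g a + g b + m * k ∸ (k + k)  ≡⟨ cong (λ u → u + m * k ∸ (k + k)) (cong₂ _+_ atA atB) ⟩
    m * k ∸ (k + k)              ≡⟨ cong (λ c → m * k ∸ (k + c)) (+-identityʳ k) ⟨
    m * k ∸ 2 * k                ≡⟨ *-distribʳ-∸ k m 2 ⟨
    (m ∸ 2) * k                  ∎
    where
    g = blockMeet N (a , i) (b , i)
    atA : g a ≡ 0
    atA = trans (count-cong (λ x → cong₂ _∧_ (blockEntry-diag N a i x)
                                              (blockEntry-off N i x (a≢b ∘ sym))))
                (count-not-∧-self (λ x → N x i))
    atB : g b ≡ 0
    atB = trans (count-cong (λ x → cong₂ _∧_ (blockEntry-off N i x a≢b) (blockEntry-diag N b i x)))
                (trans (count-∧-comm (λ x → N x i) _) (count-not-∧-self (λ x → N x i)))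
    offDiagonal : ∀ c → a ≢ c → b ≢ c → g c ≡ k
    offDiagonal c a≢c b≢c = trans (count-cong (λ x → trans (cong₂ _∧_ (blockEntry-off N i x a≢c)
                                                                        (blockEntry-off N i x b≢c))
                                                             (∧-idem (N x i))))
                                  (columnSize i)

  module _ (columnMeet : ∀ i j → i ≢ j → count (λ x → N x i ∧ N x j) ≡ l) where

    column-difference : ∀ i j → i ≢ j → count (λ x → not (N x i) ∧ N x j) + l ≡ k
    column-difference i j i≢j = begin
      count (λ x → not (N x i) ∧ N x j) + l
        ≡⟨ cong (count (λ x → not (N x i) ∧ N x j) +_) (columnMeet i j i≢j) ⟨
      count (λ x → not (N x i) ∧ N x j) + count (λ x → N x i ∧ N x j)
        ≡⟨ count-not-∧ (λ x → N x i) (λ x → N x j) ⟩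
      count (λ x → N x j)
        ≡⟨ columnSize j ⟩
      k ∎

    count-not-columns : n ≡ suc (k + k) → ∀ i j → i ≢ j →
                        count (λ x → not (N x i) ∧ not (N x j)) ≡ suc l
    count-not-columns n≡ i j i≢j = +-cancelʳ-≡ d _ (suc l) (begin
      count (λ x → not (N x i) ∧ not (N x j)) + d
        ≡⟨ cong (count (λ x → not (N x i) ∧ not (N x j)) +_)
                (count-∧-comm (λ x → not (N x j)) (λ x → N x i)) ⟩
      count (λ x → not (N x i) ∧ not (N x j)) + count (λ x → N x i ∧ not (N x j))
        ≡⟨ count-not-∧ (λ x → N x i) (λ x → not (N x j)) ⟩
      count (λ x → not (N x j))
        ≡⟨ count-not-column n≡ j ⟩
      suc k
        ≡⟨ cong suc (trans (sym (column-difference j i (i≢j ∘ sym))) (+-comm d l)) ⟩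
      suc l + d ∎)
      where
      d = count (λ x → not (N x j) ∧ N x i)

    count-column-differences : k ≡ suc (l + l) → ∀ i j → i ≢ j →
      count (λ x → not (N x i) ∧ N x j) + count (λ x → N x i ∧ not (N x j)) ≡ suc k
    count-column-differences k≡ i j i≢j = +-cancelʳ-≡ (l + l) _ (suc k) (begin
      dᵢⱼ + count (λ x → N x i ∧ not (N x j)) + (l + l)
        ≡⟨ cong (λ c → dᵢⱼ + c + (l + l)) (count-∧-comm (λ x → N x i) _) ⟩
      dᵢⱼ + dⱼᵢ + (l + l)
        ≡⟨ interchange +-commutativeSemigroup dᵢⱼ dⱼᵢ l l ⟩
      (dᵢⱼ + l) + (dⱼᵢ + l)
        ≡⟨ cong₂ _+_ (column-difference i j i≢j) (column-difference j i (i≢j ∘ sym)) ⟩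
      k + k
        ≡⟨ cong (k +_) k≡ ⟩
      k + suc (l + l)
        ≡⟨ +-suc k (l + l) ⟩
      suc k + (l + l) ∎)
      where
      dᵢⱼ = count (λ x → not (N x i) ∧ N x j)
      dⱼᵢ = count (λ x → not (N x j) ∧ N x i)

    blockMeets-sameRow : n ≡ suc (k + k) → ∀ {a b : Fin m} {i j} → a ≡ b → i ≢ j →
                         sum (blockMeet N (a , i) (b , j)) ≡ m * l + 1
    blockMeets-sameRow n≡ {a = a} {i = i} {j} refl i≢j =
      sum-except₁ (blockMeet N (a , i) (a , j)) a diagonal offDiagonal
      where
      diagonal : blockMeet N (a , i) (a , j) a ≡ suc l
      diagonal =
        trans (count-cong (λ x → cong₂ _∧_ (blockEntry-diag N a i x) (blockEntry-diag N a j x)))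
              (count-not-columns n≡ i j i≢j)
      offDiagonal : ∀ c → a ≢ c → blockMeet N (a , i) (a , j) c ≡ l
      offDiagonal c a≢c =
        trans (count-cong (λ x → cong₂ _∧_ (blockEntry-off N i x a≢c) (blockEntry-off N j x a≢c)))
              (columnMeet i j i≢j)

    blockMeets-otherwise : k ≡ suc (l + l) → ∀ {a b : Fin m} {i j} → a ≢ b → i ≢ j →
                           sum (blockMeet N (a , i) (b , j)) ≡ m * l + 2
    blockMeets-otherwise {m} k≡ {a} {b} {i} {j} a≢b i≢j = +-cancelʳ-≡ (l + l) _ (m * l + 2) (begin
      sum g + (l + l)      ≡⟨ sum-except₂ g a b a≢b offDiagonal ⟩
      g a + g b + m * l    ≡⟨ cong (_+ m * l) (trans (cong₂ _+_ atA atB)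
                                                     (count-column-differences k≡ i j i≢j)) ⟩
      suc k + m * l        ≡⟨ cong (λ c → suc c + m * l) k≡ ⟩
      2 + (l + l) + m * l  ≡⟨ rearrange l (m * l) ⟩
      m * l + 2 + (l + l)  ∎)
      where
      g = blockMeet N (a , i) (b , j)
      atA : g a ≡ count (λ x → not (N x i) ∧ N x j)
      atA = count-cong (λ x → cong₂ _∧_ (blockEntry-diag N a i x) (blockEntry-off N j x (a≢b ∘ sym)))
      atB : g b ≡ count (λ x → N x i ∧ not (N x j))
      atB = count-cong (λ x → cong₂ _∧_ (blockEntry-off N i x a≢b) (blockEntry-diag N b j x))
      offDiagonal : ∀ c → a ≢ c → b ≢ c → g c ≡ l
      offDiagonal c a≢c b≢c =
        trans (count-cong (λ x → cong₂ _∧_ (blockEntry-off N i x a≢c) (blockEntry-off N j x b≢c)))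
              (columnMeet i j i≢j)
      rearrange : ∀ l p → 2 + (l + l) + p ≡ p + 2 + (l + l)
      rearrange = solve-∀

IsRD-cong : ∀ {b r k λ₁ λ₂ λ₃ m n} {N N′ : Incidence (m * n) b} →
            (∀ p q → N p q ≡ N′ p q) →
            IsRD b r k λ₁ λ₂ λ₃ m n N → IsRD b r k λ₁ λ₂ λ₃ m n N′
IsRD-cong {N = N} {N′} N≗N′ R = record
  { array        = array
  ; blockSizes   = λ q → trans (count-cong (λ p → sym (N≗N′ p q))) (blockSizes q)
  ; replications = λ p → trans (count-cong (λ q → sym (N≗N′ p q))) (replications p)
  ; sameRow      = λ p q p≢q same → trans (together-cong p q) (sameRow p q p≢q same)
  ; sameCol      = λ p q p≢q same → trans (together-cong p q) (sameCol p q p≢q same)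
  ; otherwise    = λ p q rows cols → trans (together-cong p q) (otherwise p q rows cols)
  }
  where
  open IsRD R
  together-cong : ∀ p q → together N′ p q ≡ together N p q
  together-cong p q = count-cong (λ x → sym (cong₂ _∧_ (N≗N′ p x) (N≗N′ q x)))

isRD-blockIncidence : ∀ m {N : Incidence n n} → IsSymmetricDesign n k l N →
                      IsSymmetricDesign n k l (transpose N) → n ≡ suc (k + k) → k ≡ suc (l + l) →
                      IsRD (m * n) (m * k + 1) (m * k + 1) (m * l + 1) ((m ∸ 2) * k) (m * l + 2) m n
                           (blockIncidence m N)
isRD-blockIncidence {n} m {N} D Dᵀ n≡ k≡ = record
  { array        = *↔×
  ; blockSizes   = λ q → trans (count-cong (transpose-blockIncidence m N q))
                               (replication-blockIncidence (IsSymmetricDesign.blockSizes Dᵀ) m n≡ q)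
  ; replications = replication-blockIncidence columnSize m n≡
  ; sameRow      = λ p q p≢q same → trans (together-blockIncidence m N p q)
                     (blockMeets-sameRow columnSize columnMeet {m} n≡ same
                        (p≢q ∘ remQuot-injective p q ∘ cong₂ _,_ same))
  ; sameCol      = λ p q p≢q same → trans (together-blockIncidence m N p q)
                     (blockMeets-sameColumn columnSize {m}
                        (λ rows → p≢q (remQuot-injective p q (cong₂ _,_ rows same))) same)
  ; otherwise    = λ p q rows cols → trans (together-blockIncidence m N p q)
                     (blockMeets-otherwise columnSize columnMeet {m} k≡ rows cols)
  }
  where
  columnSize = IsSymmetricDesign.blockSizes D
  columnMeet = IsSymmetricDesign.pairs Dᵀ

isSelfDualRD-blockIncidence : ∀ m {N : Incidence n n} → IsSymmetricDesign n k l N →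
  IsSymmetricDesign n k l (transpose N) → n ≡ suc (k + k) → k ≡ suc (l + l) →
  IsSelfDualRD (m * k + 1) (m * k + 1) (m * l + 1) ((m ∸ 2) * k) (m * l + 2) m n (blockIncidence m N)
isSelfDualRD-blockIncidence m {N} D Dᵀ n≡ k≡ =
  isRD-blockIncidence m D Dᵀ n≡ k≡ ,
  IsRD-cong (λ p q → sym (transpose-blockIncidence m N p q)) (isRD-blockIncidence m Dᵀ D n≡ k≡)

corollary7 : (t : ℕ) → t ≥ 1 → SkewHadamardExists t →
    (m : ℕ) → m ≥ 2 →
    Σ (Incidence (m * (4 * t ∸ 1)) (m * (4 * t ∸ 1))) (λ N →
      IsSelfDualRD (m * (2 * t ∸ 1) + 1) (m * (2 * t ∸ 1) + 1)
                   (m * (t ∸ 1) + 1) ((m ∸ 2) * (2 * t ∸ 1)) (m * (t ∸ 1) + 2)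
                   m (4 * t ∸ 1) N)
-- The construction is a rectangular design for every m; m ≥ 2 only excludes degenerate arrays.
corollary7 (suc s) _ (N , H) m _ =
  blockIncidence m N ,
  isSelfDualRD-blockIncidence m design (transpose-isSymmetricDesign skew design n≡) n≡ k≡
  where
  open IsSkewHadamard H
  k≡ : 2 * suc s ∸ 1 ≡ suc (s + s)
  k≡ = trans (cong (s +_) (+-identityʳ (suc s))) (+-suc s s)
  n≡ : 4 * suc s ∸ 1 ≡ suc ((2 * suc s ∸ 1) + (2 * suc s ∸ 1))
  n≡ = trans (reduced s) (cong (λ k → suc (k + k)) (sym k≡))
    where
    -- 4 * suc s ∸ 1 reduces to s + 3 * suc s, a form without ∸ that the ring solver accepts.
    reduced : ∀ s → s + 3 * suc s ≡ suc (suc (s + s) + suc (s + s))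
    reduced = solve-∀
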